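{- Let $t$ be an indeterminate and work in $\mathbb{Q}(t)$. For positive integers $i,l$ put \[ N_{i,l}=\frac{1}{(2i)^2-t^2(2l-1)^2} \] (the transpose of the matrix with entries $1/((2l)^2-t^2(2i-1)^2)$). For positive integers $i,j,l$ define \[ L_{i,j}=\frac{\prod_{k=1}^j\bigl((2k-1)^2t^2-(2j)^2 \bigr)}{\prod_{k=1}^j\bigl((2k-1)^2t^2-(2i)^2 \bigr)}\cdot \frac{(i+j-1)!\,j}{(i-j)!\,(2j-1)!\,i}\quad (j\le i),\qquad L_{i,j}=0\quad(j>i), \] \[ U_{j,l}=\frac{t^{2j-2}(-1)^j16^{j-1}(2j-1)!}{\prod_{k=1}^j\bigl((2l-1)^2t^2-(2k)^2 \bigr)\prod_{k=1}^{j-1}\bigl((2k-1)^2t^2-(2j)^2 \bigr)}\cdot \frac{(j+l-2)!}{j\,(l-j)!}\quad (j\le l),\qquad U_{j,l}=0\quad(j>l). \] Then for all positive integers $i,l$, $\sum_{j=1}^{\min(i,l)}L_{i,j}U_{j,l}=N_{i,l}$; i.e., for every positive integer $s$, $(N_{i,l})_{1\le i,l\le s}$ is the product of the lower unitriangular matrix $(L_{i,j})_{1\le i,j\le s}$ and the upper triangular matrix $(U_{j,l})_{1\le j,l\le s}$.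
   Context: Empty products equal $1$. The identities are identities of rational functions in $t$. -}

module Defs where

open import Data.Nat as ℕ using (ℕ; zero; suc; _∸_; _!; _≤?_)
open import Data.Integer using (+_)
open import Data.Rational using (ℚ; 0ℚ; 1ℚ; _+_; _*_; _-_; -_; _÷_; _≟_; _/_)
open import Data.Rational.Properties using ()
open import Relation.Nullary using (yes; no)
import Data.Rational.Base as QB

ι : ℕ → ℚ
ι n = + n / 1

pow : ℚ → ℕ → ℚ
pow p zero = 1ℚ
pow p (suc n) = pow p n * p

-- Division in ℚ; the value at a zero denominator is irrelevant (all
-- denominators are nonzero under the hypotheses of the theorem).
_⊘_ : ℚ → ℚ → ℚ
p ⊘ q with q ≟ 0ℚ
... | yes _ = 0ℚ
... | no q≢0 = _÷_ p q {{QB.≢-nonZero q≢0}}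

prodQ : ℕ → (ℕ → ℚ) → ℚ
prodQ zero f = 1ℚ
prodQ (suc n) f = prodQ n f * f (suc n)

sumQ : ℕ → (ℕ → ℚ) → ℚ
sumQ zero f = 0ℚ
sumQ (suc n) f = sumQ n f + f (suc n)

Nm : ℚ → ℕ → ℕ → ℚ
Nm t i l = 1ℚ ⊘ (pow (ι (2 ℕ.* i)) 2 - pow t 2 * pow (ι (2 ℕ.* l ∸ 1)) 2)

Lm : ℚ → ℕ → ℕ → ℚ
Lm t i j with j ≤? i
... | no _ = 0ℚ
... | yes _ =
  (prodQ j (λ k → pow (ι (2 ℕ.* k ∸ 1)) 2 * pow t 2 - pow (ι (2 ℕ.* j)) 2)
    ⊘ prodQ j (λ k → pow (ι (2 ℕ.* k ∸ 1)) 2 * pow t 2 - pow (ι (2 ℕ.* i)) 2))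
  * (ι (((i ℕ.+ j ∸ 1) !) ℕ.* j) ⊘ ι (((i ∸ j) !) ℕ.* ((2 ℕ.* j ∸ 1) !) ℕ.* i))

Um : ℚ → ℕ → ℕ → ℚ
Um t j l with j ≤? l
... | no _ = 0ℚ
... | yes _ =
  ((pow t (2 ℕ.* j ∸ 2) * pow (- 1ℚ) j * pow (ι 16) (j ∸ 1) * ι ((2 ℕ.* j ∸ 1) !))
    ⊘ (prodQ j (λ k → pow (ι (2 ℕ.* l ∸ 1)) 2 * pow t 2 - pow (ι (2 ℕ.* k)) 2)
       * prodQ (j ∸ 1) (λ k → pow (ι (2 ℕ.* k ∸ 1)) 2 * pow t 2 - pow (ι (2 ℕ.* j)) 2)))
  * (ι ((j ℕ.+ l ∸ 2) !) ⊘ ι (j ℕ.* ((l ∸ j) !)))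

-- Write x k = (2k)² and y k = (2k-1)² t², so that N i l = 1 / (x i - y l) and every
-- factor in L and U is a difference y - x.  The partial sums telescope: with
--   R j = ∏_{k≤j} (x k - x i) (y l - y k) / (∏_{k≤j} (y k - x i) (y l - x k) · (x i - y l))
-- we have R 0 = N i l, L i j · U j l = R (j-1) - R j, and R (min i l) = 0 because the
-- factor k = i or k = l of the numerator vanishes.  Once ∏ (x k - x i) and ∏ (y l - y k)
-- are evaluated by factorials, the step identity reduces to
--   (y j - x i) (y l - x j) - (x j - x i) (y l - y j) = (y j - x j) (y l - x i).
module Submission where

open import Defs
import Data.Rational.Properties as ℚₚ
open import Relation.Binary.PropositionalEquality
open ≡-Reasoning

-- The ℚ operators are opened only in this block, since the statement below uses ℕ's _*_.
module _ where
  open import Algebra.Apartness.Properties.HeytingCommutativeRing ℚₚ.heytingCommutativeRing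
    using () renaming (x#0y#0→xy#0 to *≢0)
  open import Algebra.Properties.Group ℚₚ.+-0-group using (x∙y⁻¹≈ε⇒x≈y)
  import Data.Integer as ℤ
  import Data.Integer.Properties as ℤₚ
  open import Data.Nat as ℕ using (ℕ; zero; suc; _!; _≤_; _⊓_; _≤?_; _∸_; s≤s; z≤n)
  open import Data.Nat.Coprimality as Coprime using (1-coprimeTo)
  import Data.Nat.Properties as ℕₚ
  open import Data.Product using (_,_; ∃-syntax)
  open import Data.Rational
    using (ℚ; 0ℚ; 1ℚ; _+_; _*_; _-_; -_; _/_; _≟_; mkℚ; 1/_; ≢-nonZero)
  open import Data.Rational.Solver using (module +-*-Solver)
  open import Data.Sum using ([_,_]′)
  open import Relation.Nullary using (yes; no)
  open import Relation.Nullary.Negation using (contradiction)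
  open +-*-Solver

  ι≡mkℚ : ∀ n → ι n ≡ mkℚ (ℤ.+ n) 0 (Coprime.sym (1-coprimeTo n))
  ι≡mkℚ n = ℚₚ.normalize-coprime (Coprime.sym (1-coprimeTo n))

  ι-suc : ∀ n → ι (suc n) ≡ 1ℚ + ι n
  ι-suc n = begin
    ι (suc n)                                          ≡⟨ cong (λ m → (ℤ.+ 1 ℤ.+ m) / 1) (sym (ℤₚ.*-identityʳ (ℤ.+ n))) ⟩
    (ℤ.+ 1 ℤ.+ ℤ.+ n ℤ.* ℤ.+ 1) / 1                    ≡⟨⟩
    1ℚ + mkℚ (ℤ.+ n) 0 (Coprime.sym (1-coprimeTo n))   ≡⟨ cong (1ℚ +_) (sym (ι≡mkℚ n)) ⟩
    1ℚ + ι n                                           ∎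

  ι-homo-+ : ∀ m n → ι (m ℕ.+ n) ≡ ι m + ι n
  ι-homo-+ zero    n = sym (ℚₚ.+-identityˡ (ι n))
  ι-homo-+ (suc m) n = begin
    ι (suc (m ℕ.+ n))   ≡⟨ ι-suc (m ℕ.+ n) ⟩
    1ℚ + ι (m ℕ.+ n)    ≡⟨ cong (1ℚ +_) (ι-homo-+ m n) ⟩
    1ℚ + (ι m + ι n)    ≡⟨ sym (ℚₚ.+-assoc 1ℚ (ι m) (ι n)) ⟩
    1ℚ + ι m + ι n      ≡⟨ cong (_+ ι n) (sym (ι-suc m)) ⟩
    ι (suc m) + ι n     ∎

  ι-homo-* : ∀ m n → ι (m ℕ.* n) ≡ ι m * ι n
  ι-homo-* zero    n = sym (ℚₚ.*-zeroˡ (ι n))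
  ι-homo-* (suc m) n = begin
    ι (n ℕ.+ m ℕ.* n)   ≡⟨ ι-homo-+ n (m ℕ.* n) ⟩
    ι n + ι (m ℕ.* n)   ≡⟨ cong (ι n +_) (ι-homo-* m n) ⟩
    ι n + ι m * ι n     ≡⟨ solve 2 (λ a b → b :+ a :* b := (con 1ℚ :+ a) :* b) refl (ι m) (ι n) ⟩
    (1ℚ + ι m) * ι n    ≡⟨ cong (_* ι n) (sym (ι-suc m)) ⟩
    ι (suc m) * ι n     ∎

  ι-odd : ∀ n → ι (2 ℕ.* suc n ∸ 1) ≡ 1ℚ + ι 2 * ι n
  ι-odd n = begin
    ι (2 ℕ.* suc n ∸ 1)   ≡⟨ cong ι (ℕₚ.+-suc n (n ℕ.+ 0)) ⟩
    ι (suc (2 ℕ.* n))     ≡⟨ ι-suc (2 ℕ.* n) ⟩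
    1ℚ + ι (2 ℕ.* n)      ≡⟨ cong (1ℚ +_) (ι-homo-* 2 n) ⟩
    1ℚ + ι 2 * ι n        ∎

  ι≢0 : ∀ n → .{{ℕ.NonZero n}} → ι n ≢ 0ℚ
  ι≢0 (suc n) eq with trans (sym (ι≡mkℚ (suc n))) eq
  ... | ()

  ι-!≢0 : ∀ n → ι (n !) ≢ 0ℚ
  ι-!≢0 n = ι≢0 (n !) {{ℕₚ._!≢0 n}}

  ι-!-pred : ∀ n → .{{ℕ.NonZero n}} → ι (n !) ≡ ι n * ι ((n ∸ 1) !)
  ι-!-pred (suc n) = ι-homo-* (suc n) (n !)

  pow-distrib-* : ∀ p q n → pow (p * q) n ≡ pow p n * pow q n
  pow-distrib-* p q zero    = refl
  pow-distrib-* p q (suc n) = begin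
    pow (p * q) n * (p * q)         ≡⟨ cong (_* (p * q)) (pow-distrib-* p q n) ⟩
    pow p n * pow q n * (p * q)     ≡⟨ solve 4 (λ P Q p q → P :* Q :* (p :* q) := P :* p :* (Q :* q)) refl (pow p n) (pow q n) p q ⟩
    pow p n * p * (pow q n * q)     ∎

  pow-even : ∀ p n → pow p (2 ℕ.* n) ≡ pow (pow p 2) n
  pow-even p zero    = refl
  pow-even p (suc n) = begin
    pow p (2 ℕ.* suc n)            ≡⟨ cong (λ m → pow p (suc m)) (ℕₚ.+-suc n (n ℕ.+ 0)) ⟩
    pow p (2 ℕ.* n) * p * p        ≡⟨ cong (λ q → q * p * p) (pow-even p n) ⟩
    pow (pow p 2) n * p * p        ≡⟨ solve 2 (λ P p → P :* p :* p := P :* (con 1ℚ :* p :* p)) refl (pow (pow p 2) n) p ⟩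
    pow (pow p 2) n * pow p 2      ∎

  ⊘≡*1/ : ∀ p {q} (q≢0 : q ≢ 0ℚ) → p ⊘ q ≡ p * (1/ q) {{≢-nonZero q≢0}}
  ⊘≡*1/ p {q} q≢0 with q ≟ 0ℚ
  ... | yes q≡0 = contradiction q≡0 q≢0
  ... | no  _   = refl

  ⊘-*-cancelʳ : ∀ p {q} → q ≢ 0ℚ → (p ⊘ q) * q ≡ p
  ⊘-*-cancelʳ p {q} q≢0 = begin
    (p ⊘ q) * q        ≡⟨ cong (_* q) (⊘≡*1/ p q≢0) ⟩
    p * 1/ q * q       ≡⟨ ℚₚ.*-assoc p (1/ q) q ⟩
    p * (1/ q * q)     ≡⟨ cong (p *_) (ℚₚ.*-inverseˡ q) ⟩
    p * 1ℚ             ≡⟨ ℚₚ.*-identityʳ p ⟩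
    p                  ∎
    where instance _ = ≢-nonZero q≢0

  ⊘-unique : ∀ {r p q} → q ≢ 0ℚ → r * q ≡ p → r ≡ p ⊘ q
  ⊘-unique {r} {p} {q} q≢0 r*q≡p = begin
    r                  ≡⟨ sym (ℚₚ.*-identityʳ r) ⟩
    r * 1ℚ             ≡⟨ cong (r *_) (sym (ℚₚ.*-inverseʳ q)) ⟩
    r * (q * 1/ q)     ≡⟨ sym (ℚₚ.*-assoc r q (1/ q)) ⟩
    r * q * 1/ q       ≡⟨ cong (_* 1/ q) r*q≡p ⟩
    p * 1/ q           ≡⟨ sym (⊘≡*1/ p q≢0) ⟩
    p ⊘ q              ∎
    where instance _ = ≢-nonZero q≢0

  ⊘-cross : ∀ {a b c d} → b ≢ 0ℚ → d ≢ 0ℚ → a * d ≡ c * b → a ⊘ b ≡ c ⊘ d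
  ⊘-cross {a} {b} {c} {d} b≢0 d≢0 ad≡cb = ⊘-unique d≢0 (begin
    (a ⊘ b) * d          ≡⟨ ⊘-unique b≢0 [a⊘b]db≡cb ⟩
    (c * b) ⊘ b          ≡⟨ sym (⊘-unique b≢0 refl) ⟩
    c                    ∎)
    where
    [a⊘b]db≡cb : (a ⊘ b) * d * b ≡ c * b
    [a⊘b]db≡cb = begin
      (a ⊘ b) * d * b    ≡⟨ solve 3 (λ r d b → r :* d :* b := r :* b :* d) refl (a ⊘ b) d b ⟩
      (a ⊘ b) * b * d    ≡⟨ cong (_* d) (⊘-*-cancelʳ a b≢0) ⟩
      a * d              ≡⟨ ad≡cb ⟩
      c * b              ∎

  ⊘-mul : ∀ {a b c d} → b ≢ 0ℚ → d ≢ 0ℚ → (a ⊘ b) * (c ⊘ d) ≡ (a * c) ⊘ (b * d)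
  ⊘-mul {a} {b} {c} {d} b≢0 d≢0 = ⊘-unique (*≢0 b≢0 d≢0) (begin
    (a ⊘ b) * (c ⊘ d) * (b * d)      ≡⟨ solve 4 (λ r s b d → r :* s :* (b :* d) := r :* b :* (s :* d)) refl (a ⊘ b) (c ⊘ d) b d ⟩
    (a ⊘ b) * b * ((c ⊘ d) * d)      ≡⟨ cong₂ _*_ (⊘-*-cancelʳ a b≢0) (⊘-*-cancelʳ c d≢0) ⟩
    a * c                            ∎)

  ⊘-sub : ∀ {a b c d} → b ≢ 0ℚ → d ≢ 0ℚ → a ⊘ b - c ⊘ d ≡ (a * d - c * b) ⊘ (b * d)
  ⊘-sub {a} {b} {c} {d} b≢0 d≢0 = ⊘-unique (*≢0 b≢0 d≢0) (begin
    (a ⊘ b - c ⊘ d) * (b * d)              ≡⟨ solve 4 (λ r s b d → (r :- s) :* (b :* d) := r :* b :* d :- s :* d :* b) refl (a ⊘ b) (c ⊘ d) b d ⟩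
    (a ⊘ b) * b * d - (c ⊘ d) * d * b      ≡⟨ cong₂ (λ u v → u * d - v * b) (⊘-*-cancelʳ a b≢0) (⊘-*-cancelʳ c d≢0) ⟩
    a * d - c * b                          ∎)

  0⊘q≡0 : ∀ q → 0ℚ ⊘ q ≡ 0ℚ
  0⊘q≡0 q with q ≟ 0ℚ
  ... | yes _   = refl
  ... | no  q≢0 = ℚₚ.*-zeroˡ ((1/ q) {{≢-nonZero q≢0}})

  -- The shape of R j - R (j+1) for the remainders R below: G, H are the products
  -- up to j, g, h their next factors.
  ⊘-telescope-step : ∀ {G H D g h e} → H ≢ 0ℚ → h ≢ 0ℚ → D ≢ 0ℚ → h - g ≡ - (D * e) →
                     G ⊘ (H * D) - (G * g) ⊘ (H * h * D) ≡ (- (G * e)) ⊘ (H * h)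
  ⊘-telescope-step {G} {H} {D} {g} {h} {e} H≢0 h≢0 D≢0 h-g≡-De = begin
    G ⊘ (H * D) - (G * g) ⊘ (H * h * D)
      ≡⟨ ⊘-sub HD≢0 HhD≢0 ⟩
    (G * (H * h * D) - G * g * (H * D)) ⊘ (H * D * (H * h * D))
      ≡⟨ ⊘-cross (*≢0 HD≢0 HhD≢0) (*≢0 H≢0 h≢0) cross ⟩
    (- (G * e)) ⊘ (H * h)
      ∎
    where
    HD≢0 : H * D ≢ 0ℚ
    HD≢0 = *≢0 H≢0 D≢0
    HhD≢0 : H * h * D ≢ 0ℚ
    HhD≢0 = *≢0 (*≢0 H≢0 h≢0) D≢0
    cross : (G * (H * h * D) - G * g * (H * D)) * (H * h) ≡ (- (G * e)) * (H * D * (H * h * D))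
    cross = begin
      (G * (H * h * D) - G * g * (H * D)) * (H * h)
        ≡⟨ solve 5 (λ G H D g h → (G :* (H :* h :* D) :- G :* g :* (H :* D)) :* (H :* h)
                                  := G :* H :* D :* H :* h :* (h :- g)) refl G H D g h ⟩
      G * H * D * H * h * (h - g)
        ≡⟨ cong (G * H * D * H * h *_) h-g≡-De ⟩
      G * H * D * H * h * (- (D * e))
        ≡⟨ solve 6 (λ G H D g h e → G :* H :* D :* H :* h :* (:- (D :* e))
                                    := (:- (G :* e)) :* (H :* D :* (H :* h :* D))) refl G H D g h e ⟩
      (- (G * e)) * (H * D * (H * h * D))
        ∎

  sumQ-telescope : ∀ n {f} (r : ℕ → ℚ) → (∀ {j} → suc j ≤ n → f (suc j) ≡ r j - r (suc j)) →
                   sumQ n f ≡ r 0 - r n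
  sumQ-telescope zero    r _    = sym (ℚₚ.+-inverseʳ (r 0))
  sumQ-telescope (suc n) {f} r step = begin
    sumQ n f + f (suc n)                     ≡⟨ cong₂ _+_ (sumQ-telescope n r (λ j<n → step (ℕₚ.m≤n⇒m≤1+n j<n))) (step ℕₚ.≤-refl) ⟩
    (r 0 - r n) + (r n - r (suc n))          ≡⟨ solve 3 (λ a b c → (a :- b) :+ (b :- c) := a :- c) refl (r 0) (r n) (r (suc n)) ⟩
    r 0 - r (suc n)                          ∎

  prodQ-* : ∀ n f g → prodQ n (λ k → f k * g k) ≡ prodQ n f * prodQ n g
  prodQ-* zero    f g = refl
  prodQ-* (suc n) f g = begin
    prodQ n (λ k → f k * g k) * (f (suc n) * g (suc n))   ≡⟨ cong (_* (f (suc n) * g (suc n))) (prodQ-* n f g) ⟩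
    prodQ n f * prodQ n g * (f (suc n) * g (suc n))       ≡⟨ solve 4 (λ P Q a b → P :* Q :* (a :* b) := P :* a :* (Q :* b)) refl (prodQ n f) (prodQ n g) (f (suc n)) (g (suc n)) ⟩
    prodQ n f * f (suc n) * (prodQ n g * g (suc n))       ∎

  prodQ≢0 : ∀ n f → (∀ k → f (suc k) ≢ 0ℚ) → prodQ n f ≢ 0ℚ
  prodQ≢0 zero    f _   = ℚₚ.1≢0
  prodQ≢0 (suc n) f f≢0 = *≢0 (prodQ≢0 n f f≢0) (f≢0 n)

  x : ℕ → ℚ
  x k = pow (ι (2 ℕ.* k)) 2

  y : ℚ → ℕ → ℚ
  y t k = pow (ι (2 ℕ.* k ∸ 1)) 2 * pow t 2

  x-diff : ∀ m n → x m - x (m ℕ.+ n) ≡ - (ι 4 * ι n * ι (m ℕ.+ n ℕ.+ m))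
  x-diff m n = begin
    x m - x (m ℕ.+ n)
      ≡⟨ cong₂ (λ u v → pow u 2 - pow v 2) (ι-homo-* 2 m) (trans (ι-homo-* 2 (m ℕ.+ n)) (cong (ι 2 *_) (ι-homo-+ m n))) ⟩
    pow (ι 2 * ι m) 2 - pow (ι 2 * (ι m + ι n)) 2
      ≡⟨ solve 2 (λ M N → con 1ℚ :* (con (ι 2) :* M) :* (con (ι 2) :* M)
                          :- con 1ℚ :* (con (ι 2) :* (M :+ N)) :* (con (ι 2) :* (M :+ N))
                          := :- (con (ι 4) :* N :* (M :+ N :+ M))) refl (ι m) (ι n) ⟩
    - (ι 4 * ι n * (ι m + ι n + ι m))
      ≡⟨ cong (λ z → - (ι 4 * ι n * z)) (sym (trans (ι-homo-+ (m ℕ.+ n) m) (cong (_+ ι m) (ι-homo-+ m n)))) ⟩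
    - (ι 4 * ι n * ι (m ℕ.+ n ℕ.+ m))
      ∎

  y-diff : ∀ t m n → y t (suc m ℕ.+ n) - y t (suc m) ≡ ι 4 * pow t 2 * ι n * ι (suc m ℕ.+ n ℕ.+ m)
  y-diff t m n = begin
    y t (suc m ℕ.+ n) - y t (suc m)
      ≡⟨ cong₂ (λ u v → pow u 2 * pow t 2 - pow v 2 * pow t 2)
               (trans (ι-odd (m ℕ.+ n)) (cong (λ z → 1ℚ + ι 2 * z) (ι-homo-+ m n))) (ι-odd m) ⟩
    pow (1ℚ + ι 2 * (ι m + ι n)) 2 * pow t 2 - pow (1ℚ + ι 2 * ι m) 2 * pow t 2
      ≡⟨ solve 3 (λ M N T → con 1ℚ :* (con 1ℚ :+ con (ι 2) :* (M :+ N)) :* (con 1ℚ :+ con (ι 2) :* (M :+ N)) :* (con 1ℚ :* T :* T)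
                            :- con 1ℚ :* (con 1ℚ :+ con (ι 2) :* M) :* (con 1ℚ :+ con (ι 2) :* M) :* (con 1ℚ :* T :* T)
                            := con (ι 4) :* (con 1ℚ :* T :* T) :* N :* (con 1ℚ :+ (M :+ N :+ M))) refl (ι m) (ι n) t ⟩
    ι 4 * pow t 2 * ι n * (1ℚ + (ι m + ι n + ι m))
      ≡⟨ cong (λ z → ι 4 * pow t 2 * ι n * z)
              (sym (trans (ι-suc (m ℕ.+ n ℕ.+ m)) (cong (1ℚ +_) (trans (ι-homo-+ (m ℕ.+ n) m) (cong (_+ ι m) (ι-homo-+ m n)))))) ⟩
    ι 4 * pow t 2 * ι n * ι (suc m ℕ.+ n ℕ.+ m)
      ∎

  ∏[xₖ-xᵢ]-factorial : ∀ j a {i} → i ≡ j ℕ.+ suc a →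
    prodQ j (λ k → x k - x i) * ι (a !) * ι i ≡ pow (- 1ℚ) j * pow (ι 4) j * ι ((i ℕ.+ j) !)
  ∏[xₖ-xᵢ]-factorial zero a refl = begin
    1ℚ * ι (a !) * ι (suc a)          ≡⟨ solve 2 (λ F S → con 1ℚ :* F :* S := con 1ℚ :* con 1ℚ :* (S :* F)) refl (ι (a !)) (ι (suc a)) ⟩
    1ℚ * 1ℚ * (ι (suc a) * ι (a !))   ≡⟨ cong (1ℚ * 1ℚ *_) (sym (ι-homo-* (suc a) (a !))) ⟩
    1ℚ * 1ℚ * ι (suc a !)             ≡⟨ cong (λ n → 1ℚ * 1ℚ * ι (n !)) (sym (ℕₚ.+-identityʳ (suc a))) ⟩
    1ℚ * 1ℚ * ι ((suc a ℕ.+ 0) !)     ∎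
  ∏[xₖ-xᵢ]-factorial (suc j) a {i} refl = begin
    Π * (x (suc j) - x i) * ι (a !) * ι i
      ≡⟨ cong (λ z → Π * z * ι (a !) * ι i) (x-diff (suc j) (suc a)) ⟩
    Π * (- (ι 4 * ι (suc a) * ι (i ℕ.+ suc j))) * ι (a !) * ι i
      ≡⟨ solve 6 (λ P A F I X S → P :* (:- (con (ι 4) :* A :* S)) :* F :* I := P :* (A :* F) :* I :* (:- con (ι 4) :* S))
                 refl Π (ι (suc a)) (ι (a !)) (ι i) (ι 4) (ι (i ℕ.+ suc j)) ⟩
    Π * (ι (suc a) * ι (a !)) * ι i * (- ι 4 * ι (i ℕ.+ suc j))
      ≡⟨ cong (λ z → Π * z * ι i * (- ι 4 * ι (i ℕ.+ suc j))) (sym (ι-homo-* (suc a) (a !))) ⟩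
    Π * ι (suc a !) * ι i * (- ι 4 * ι (i ℕ.+ suc j))
      ≡⟨ cong (_* (- ι 4 * ι (i ℕ.+ suc j))) (∏[xₖ-xᵢ]-factorial j (suc a) (sym (ℕₚ.+-suc j (suc a)))) ⟩
    pow (- 1ℚ) j * pow (ι 4) j * ι ((i ℕ.+ j) !) * (- ι 4 * ι (i ℕ.+ suc j))
      ≡⟨ solve 4 (λ S P F X → S :* P :* F :* (:- con (ι 4) :* X) := S :* (:- con 1ℚ) :* (P :* con (ι 4)) :* (X :* F))
                 refl (pow (- 1ℚ) j) (pow (ι 4) j) (ι ((i ℕ.+ j) !)) (ι (i ℕ.+ suc j)) ⟩
    pow (- 1ℚ) j * - 1ℚ * (pow (ι 4) j * ι 4) * (ι (i ℕ.+ suc j) * ι ((i ℕ.+ j) !))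
      ≡⟨ cong (pow (- 1ℚ) j * - 1ℚ * (pow (ι 4) j * ι 4) *_)
              (sym (trans (ι-!-pred (i ℕ.+ suc j)) (cong (λ n → ι (i ℕ.+ suc j) * ι ((n ∸ 1) !)) (ℕₚ.+-suc i j)))) ⟩
    pow (- 1ℚ) j * - 1ℚ * (pow (ι 4) j * ι 4) * ι ((i ℕ.+ suc j) !)
      ∎
    where
    Π : ℚ
    Π = prodQ j (λ k → x k - x i)

  ∏[yₗ-yₖ]-factorial : ∀ t j b {l} → l ≡ j ℕ.+ suc b →
    prodQ j (λ k → y t l - y t k) * ι (b !) ≡ pow (ι 4) j * pow (pow t 2) j * ι ((l ℕ.+ j ∸ 1) !)
  ∏[yₗ-yₖ]-factorial t zero b refl = begin
    1ℚ * ι (b !)                  ≡⟨ solve 1 (λ F → con 1ℚ :* F := con 1ℚ :* con 1ℚ :* F) refl (ι (b !)) ⟩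
    1ℚ * 1ℚ * ι (b !)             ≡⟨ cong (λ n → 1ℚ * 1ℚ * ι ((n ∸ 1) !)) (sym (ℕₚ.+-identityʳ (suc b))) ⟩
    1ℚ * 1ℚ * ι ((suc b ℕ.+ 0 ∸ 1) !) ∎
  ∏[yₗ-yₖ]-factorial t (suc j) b {l} refl = begin
    Π * (y t l - y t (suc j)) * ι (b !)
      ≡⟨ cong (λ z → Π * z * ι (b !)) (y-diff t j (suc b)) ⟩
    Π * (ι 4 * T * ι (suc b) * ι (l ℕ.+ j)) * ι (b !)
      ≡⟨ solve 5 (λ P T B X F → P :* (con (ι 4) :* T :* B :* X) :* F := P :* (B :* F) :* (con (ι 4) :* T :* X))
                 refl Π T (ι (suc b)) (ι (l ℕ.+ j)) (ι (b !)) ⟩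
    Π * (ι (suc b) * ι (b !)) * (ι 4 * T * ι (l ℕ.+ j))
      ≡⟨ cong (λ z → Π * z * (ι 4 * T * ι (l ℕ.+ j))) (sym (ι-homo-* (suc b) (b !))) ⟩
    Π * ι (suc b !) * (ι 4 * T * ι (l ℕ.+ j))
      ≡⟨ cong (_* (ι 4 * T * ι (l ℕ.+ j))) (∏[yₗ-yₖ]-factorial t j (suc b) (sym (ℕₚ.+-suc j (suc b)))) ⟩
    pow (ι 4) j * pow T j * ι ((l ℕ.+ j ∸ 1) !) * (ι 4 * T * ι (l ℕ.+ j))
      ≡⟨ solve 5 (λ P Q F T X → P :* Q :* F :* (con (ι 4) :* T :* X) := P :* con (ι 4) :* (Q :* T) :* (X :* F))
                 refl (pow (ι 4) j) (pow T j) (ι ((l ℕ.+ j ∸ 1) !)) T (ι (l ℕ.+ j)) ⟩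
    pow (ι 4) j * ι 4 * (pow T j * T) * (ι (l ℕ.+ j) * ι ((l ℕ.+ j ∸ 1) !))
      ≡⟨ cong (pow (ι 4) j * ι 4 * (pow T j * T) *_)
              (sym (trans (cong (λ n → ι ((n ∸ 1) !)) (ℕₚ.+-suc l j)) (ι-!-pred (l ℕ.+ j)))) ⟩
    pow (ι 4) j * ι 4 * (pow T j * T) * ι ((l ℕ.+ suc j ∸ 1) !)
      ∎
    where
    T Π : ℚ
    T = pow t 2
    Π = prodQ j (λ k → y t l - y t k)

  module _ (t : ℚ) where

    Δ : ℕ → ℕ → ℚ
    Δ i l = pow (ι (2 ℕ.* i)) 2 - pow t 2 * pow (ι (2 ℕ.* l ∸ 1)) 2

    numer : ℕ → ℕ → ℕ → ℚ
    numer i l k = (x k - x i) * (y t l - y t k)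

    denom : ℕ → ℕ → ℕ → ℚ
    denom i l k = (y t k - x i) * (y t l - x k)

    -- R i l j = N i l - Σ_{j' ≤ j} L i j' · U j' l.
    R : ℕ → ℕ → ℕ → ℚ
    R i l j = prodQ j (numer i l) ⊘ (prodQ j (denom i l) * Δ i l)

    R-zero : ∀ i l → R i l 0 ≡ Nm t i l
    R-zero i l = cong (1ℚ ⊘_) (ℚₚ.*-identityˡ (Δ i l))

    numer-vanishes : ∀ i l → numer i l (i ⊓ l) ≡ 0ℚ
    numer-vanishes i l = [ at-i , at-l ]′ (ℕₚ.⊓-sel i l)
      where
      at-i : i ⊓ l ≡ i → numer i l (i ⊓ l) ≡ 0ℚ
      at-i i⊓l≡i = begin
        numer i l (i ⊓ l)               ≡⟨ cong (numer i l) i⊓l≡i ⟩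
        (x i - x i) * (y t l - y t i)   ≡⟨ cong (_* (y t l - y t i)) (ℚₚ.+-inverseʳ (x i)) ⟩
        0ℚ * (y t l - y t i)            ≡⟨ ℚₚ.*-zeroˡ (y t l - y t i) ⟩
        0ℚ                              ∎
      at-l : i ⊓ l ≡ l → numer i l (i ⊓ l) ≡ 0ℚ
      at-l i⊓l≡l = begin
        numer i l (i ⊓ l)               ≡⟨ cong (numer i l) i⊓l≡l ⟩
        (x l - x i) * (y t l - y t l)   ≡⟨ cong ((x l - x i) *_) (ℚₚ.+-inverseʳ (y t l)) ⟩
        (x l - x i) * 0ℚ                ≡⟨ ℚₚ.*-zeroʳ (x l - x i) ⟩
        0ℚ                              ∎

    R-vanishes : ∀ {i l} → 1 ≤ i → 1 ≤ l → R i l (i ⊓ l) ≡ 0ℚ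
    R-vanishes {suc i} {suc l} _ _ = begin
      (Π * numer (suc i) (suc l) (suc i ⊓ suc l)) ⊘ H   ≡⟨ cong (λ z → (Π * z) ⊘ H) (numer-vanishes (suc i) (suc l)) ⟩
      (Π * 0ℚ) ⊘ H                                       ≡⟨ cong (_⊘ H) (ℚₚ.*-zeroʳ Π) ⟩
      0ℚ ⊘ H                                             ≡⟨ 0⊘q≡0 H ⟩
      0ℚ                                                 ∎
      where
      Π H : ℚ
      Π = prodQ (i ⊓ l) (numer (suc i) (suc l))
      H = prodQ (suc (i ⊓ l)) (denom (suc i) (suc l)) * Δ (suc i) (suc l)

    denom-numer : ∀ i l k → denom i l k - numer i l k ≡ - (Δ i l * (y t k - x k))
    denom-numer i l k =
      solve 5 (λ Xk Xi Uk Ul T → (Uk :* T :- Xi) :* (Ul :* T :- Xk) :- (Xk :- Xi) :* (Ul :* T :- Uk :* T)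
                                 := :- ((Xi :- T :* Ul) :* (Uk :* T :- Xk)))
              refl (x k) (x i) (pow (ι (2 ℕ.* k ∸ 1)) 2) (pow (ι (2 ℕ.* l ∸ 1)) 2) (pow t 2)

    Lm-≤ : ∀ {i j} → j ≤ i →
      Lm t i j ≡ (prodQ j (λ k → y t k - x j) ⊘ prodQ j (λ k → y t k - x i))
                 * (ι (((i ℕ.+ j ∸ 1) !) ℕ.* j) ⊘ ι (((i ∸ j) !) ℕ.* ((2 ℕ.* j ∸ 1) !) ℕ.* i))
    Lm-≤ {i} {j} j≤i with j ≤? i
    ... | yes _   = refl
    ... | no  j≰i = contradiction j≤i j≰i

    Um-≤ : ∀ {j l} → j ≤ l →
      Um t j l ≡ ((pow t (2 ℕ.* j ∸ 2) * pow (- 1ℚ) j * pow (ι 16) (j ∸ 1) * ι ((2 ℕ.* j ∸ 1) !))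
                   ⊘ (prodQ j (λ k → y t l - x k) * prodQ (j ∸ 1) (λ k → y t k - x j)))
                 * (ι ((j ℕ.+ l ∸ 2) !) ⊘ ι (j ℕ.* ((l ∸ j) !)))
    Um-≤ {j} {l} j≤l with j ≤? l
    ... | yes _   = refl
    ... | no  j≰l = contradiction j≤l j≰l

    Lm-unfold : ∀ j a → let i = suc j ℕ.+ a; s = suc j in
      Lm t i s ≡ (prodQ s (λ k → y t k - x s) ⊘ prodQ s (λ k → y t k - x i))
               * ((ι ((i ℕ.+ j) !) * ι s) ⊘ (ι (a !) * ι ((2 ℕ.* s ∸ 1) !) * ι i))
    Lm-unfold j a = trans (Lm-≤ (ℕₚ.m≤m+n s a))
      (cong₂ (λ p q → (prodQ s (λ k → y t k - x s) ⊘ prodQ s (λ k → y t k - x i)) * (p ⊘ q)) numerator denominator)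
      where
      i s : ℕ
      i = suc j ℕ.+ a
      s = suc j
      numerator : ι (((i ℕ.+ s ∸ 1) !) ℕ.* s) ≡ ι ((i ℕ.+ j) !) * ι s
      numerator = begin
        ι (((i ℕ.+ s ∸ 1) !) ℕ.* s)     ≡⟨ ι-homo-* ((i ℕ.+ s ∸ 1) !) s ⟩
        ι ((i ℕ.+ s ∸ 1) !) * ι s       ≡⟨ cong (λ n → ι ((n ∸ 1) !) * ι s) (ℕₚ.+-suc i j) ⟩
        ι ((i ℕ.+ j) !) * ι s           ∎
      denominator : ι (((i ∸ s) !) ℕ.* ((2 ℕ.* s ∸ 1) !) ℕ.* i) ≡ ι (a !) * ι ((2 ℕ.* s ∸ 1) !) * ι i
      denominator = begin
        ι (((i ∸ s) !) ℕ.* ((2 ℕ.* s ∸ 1) !) ℕ.* i)   ≡⟨ ι-homo-* ((i ∸ s) ! ℕ.* (2 ℕ.* s ∸ 1) !) i ⟩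
        ι (((i ∸ s) !) ℕ.* ((2 ℕ.* s ∸ 1) !)) * ι i   ≡⟨ cong (_* ι i) (ι-homo-* ((i ∸ s) !) ((2 ℕ.* s ∸ 1) !)) ⟩
        ι ((i ∸ s) !) * ι ((2 ℕ.* s ∸ 1) !) * ι i     ≡⟨ cong (λ n → ι (n !) * ι ((2 ℕ.* s ∸ 1) !) * ι i) (ℕₚ.m+n∸m≡n j a) ⟩
        ι (a !) * ι ((2 ℕ.* s ∸ 1) !) * ι i           ∎

    Um-unfold : ∀ j b → let l = suc j ℕ.+ b; s = suc j in
      Um t s l ≡ ((pow (pow t 2) j * pow (- 1ℚ) s * (pow (ι 4) j * pow (ι 4) j) * ι ((2 ℕ.* s ∸ 1) !))
                   ⊘ (prodQ s (λ k → y t l - x k) * prodQ j (λ k → y t k - x s)))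
               * (ι ((l ℕ.+ j ∸ 1) !) ⊘ (ι s * ι (b !)))
    Um-unfold j b = trans (Um-≤ (ℕₚ.m≤m+n s b))
      (cong₂ (λ p q → (p ⊘ (prodQ s (λ k → y t l - x k) * prodQ j (λ k → y t k - x s))) * q)
        (cong₂ (λ u v → u * pow (- 1ℚ) s * v * ι ((2 ℕ.* s ∸ 1) !)) t-power sixteen-power)
        (cong₂ _⊘_ numerator denominator))
      where
      l s : ℕ
      l = suc j ℕ.+ b
      s = suc j
      t-power : pow t (2 ℕ.* s ∸ 2) ≡ pow (pow t 2) j
      t-power = trans (cong (pow t) (sym (ℕₚ.*-distribˡ-∸ 2 s 1))) (pow-even t j)
      sixteen-power : pow (ι 16) j ≡ pow (ι 4) j * pow (ι 4) j
      sixteen-power = pow-distrib-* (ι 4) (ι 4) j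
      numerator : ι ((s ℕ.+ l ∸ 2) !) ≡ ι ((l ℕ.+ j ∸ 1) !)
      numerator = cong (λ n → ι ((n ∸ 1) !)) (ℕₚ.+-comm j l)
      denominator : ι (s ℕ.* ((l ∸ s) !)) ≡ ι s * ι (b !)
      denominator = trans (ι-homo-* s ((l ∸ s) !)) (cong (λ n → ι s * ι (n !)) (ℕₚ.m+n∸m≡n j b))

    module _ (y≢x : ∀ a b → 1 ≤ a → 1 ≤ b → y t b ≢ x a) where

      y-x≢0 : ∀ k m → y t (suc k) - x (suc m) ≢ 0ℚ
      y-x≢0 k m eq = y≢x (suc m) (suc k) (s≤s z≤n) (s≤s z≤n) (x∙y⁻¹≈ε⇒x≈y _ _ eq)

      Δ≢0 : ∀ i l → Δ (suc i) (suc l) ≢ 0ℚ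
      Δ≢0 i l eq = y≢x (suc i) (suc l) (s≤s z≤n) (s≤s z≤n)
        (trans (ℚₚ.*-comm (pow (ι (2 ℕ.* suc l ∸ 1)) 2) (pow t 2)) (sym (x∙y⁻¹≈ε⇒x≈y _ _ eq)))

      module Step (j a b : ℕ) where

        i l s : ℕ
        i = suc j ℕ.+ a
        l = suc j ℕ.+ b
        s = suc j

        A B C X Y e₁ e₂ e₃ : ℚ
        A = prodQ j (λ k → y t k - x s)
        B = prodQ j (λ k → y t k - x i)
        C = prodQ j (λ k → y t l - x k)
        X = prodQ j (λ k → x k - x i)
        Y = prodQ j (λ k → y t l - y t k)
        e₁ = y t s - x s
        e₂ = y t s - x i
        e₃ = y t l - x s

        f₁ f₂ f₃ f₄ f₅ fᵢ fₛ τ σ π : ℚ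
        f₁ = ι ((i ℕ.+ j) !)
        f₂ = ι (a !)
        f₃ = ι ((2 ℕ.* s ∸ 1) !)
        f₄ = ι ((l ℕ.+ j ∸ 1) !)
        f₅ = ι (b !)
        fᵢ = ι i
        fₛ = ι s
        τ = pow (pow t 2) j
        σ = pow (- 1ℚ) j
        π = pow (ι 4) j

        N M : ℚ
        N = A * e₁ * (f₁ * fₛ) * (τ * (σ * - 1ℚ) * (π * π) * f₃ * f₄)
        M = B * e₂ * (f₂ * f₃ * fᵢ) * (C * e₃ * A * (fₛ * f₅))

        A≢0 : A ≢ 0ℚ
        A≢0 = prodQ≢0 j _ (λ k → y-x≢0 k j)

        B≢0 : B ≢ 0ℚ
        B≢0 = prodQ≢0 j _ (λ k → y-x≢0 k (j ℕ.+ a))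

        C≢0 : C ≢ 0ℚ
        C≢0 = prodQ≢0 j _ (λ k → y-x≢0 (j ℕ.+ b) k)

        e₂≢0 : e₂ ≢ 0ℚ
        e₂≢0 = y-x≢0 j (j ℕ.+ a)

        e₃≢0 : e₃ ≢ 0ℚ
        e₃≢0 = y-x≢0 (j ℕ.+ b) j

        f₂f₃fᵢ≢0 : f₂ * f₃ * fᵢ ≢ 0ℚ
        f₂f₃fᵢ≢0 = *≢0 (*≢0 (ι-!≢0 a) (ι-!≢0 (2 ℕ.* s ∸ 1))) (ι≢0 i)

        fₛf₅≢0 : fₛ * f₅ ≢ 0ℚ
        fₛf₅≢0 = *≢0 (ι≢0 s) (ι-!≢0 b)

        M≢0 : M ≢ 0ℚ
        M≢0 = *≢0 (*≢0 (*≢0 B≢0 e₂≢0) f₂f₃fᵢ≢0) (*≢0 (*≢0 (*≢0 C≢0 e₃≢0) A≢0) fₛf₅≢0)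

        Lm*Um≡N⊘M : Lm t i s * Um t s l ≡ N ⊘ M
        Lm*Um≡N⊘M = begin
          Lm t i s * Um t s l
            ≡⟨ cong₂ _*_ (Lm-unfold j a) (Um-unfold j b) ⟩
          ((A * e₁) ⊘ (B * e₂)) * ((f₁ * fₛ) ⊘ (f₂ * f₃ * fᵢ))
            * (((τ * (σ * - 1ℚ) * (π * π) * f₃) ⊘ (C * e₃ * A)) * (f₄ ⊘ (fₛ * f₅)))
            ≡⟨ cong₂ _*_ (⊘-mul (*≢0 B≢0 e₂≢0) f₂f₃fᵢ≢0) (⊘-mul (*≢0 (*≢0 C≢0 e₃≢0) A≢0) fₛf₅≢0) ⟩
          ((A * e₁ * (f₁ * fₛ)) ⊘ (B * e₂ * (f₂ * f₃ * fᵢ)))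
            * ((τ * (σ * - 1ℚ) * (π * π) * f₃ * f₄) ⊘ (C * e₃ * A * (fₛ * f₅)))
            ≡⟨ ⊘-mul (*≢0 (*≢0 B≢0 e₂≢0) f₂f₃fᵢ≢0) (*≢0 (*≢0 (*≢0 C≢0 e₃≢0) A≢0) fₛf₅≢0) ⟩
          N ⊘ M
            ∎

        N-cross : N * (B * C * (e₂ * e₃)) ≡ (- (X * Y * e₁)) * M
        N-cross = begin
          N * (B * C * (e₂ * e₃))
            ≡⟨ solve 13 (λ A B C e₁ e₂ e₃ f₁ f₃ f₄ fₛ τ σ π →
                 A :* e₁ :* (f₁ :* fₛ) :* (τ :* (σ :* :- con 1ℚ) :* (π :* π) :* f₃ :* f₄) :* (B :* C :* (e₂ :* e₃))
                 := σ :* π :* f₁ :* (π :* τ :* f₄) :* (:- (A :* e₁ :* fₛ :* f₃ :* B :* C :* e₂ :* e₃)))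
               refl A B C e₁ e₂ e₃ f₁ f₃ f₄ fₛ τ σ π ⟩
          σ * π * f₁ * (π * τ * f₄) * K
            ≡⟨ cong₂ (λ p q → p * q * K) (sym (∏[xₖ-xᵢ]-factorial j a (sym (ℕₚ.+-suc j a))))
                                         (sym (∏[yₗ-yₖ]-factorial t j b (sym (ℕₚ.+-suc j b)))) ⟩
          X * f₂ * fᵢ * (Y * f₅) * K
            ≡⟨ solve 13 (λ A B C e₁ e₂ e₃ f₂ f₃ f₅ fᵢ fₛ X Y →
                 X :* f₂ :* fᵢ :* (Y :* f₅) :* (:- (A :* e₁ :* fₛ :* f₃ :* B :* C :* e₂ :* e₃))
                 := (:- (X :* Y :* e₁)) :* (B :* e₂ :* (f₂ :* f₃ :* fᵢ) :* (C :* e₃ :* A :* (fₛ :* f₅))))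
               refl A B C e₁ e₂ e₃ f₂ f₃ f₅ fᵢ fₛ X Y ⟩
          (- (X * Y * e₁)) * M
            ∎
          where
          K : ℚ
          K = - (A * e₁ * fₛ * f₃ * B * C * e₂ * e₃)

        Lm*Um≡R-R : Lm t i s * Um t s l ≡ R i l j - R i l s
        Lm*Um≡R-R = begin
          Lm t i s * Um t s l
            ≡⟨ Lm*Um≡N⊘M ⟩
          N ⊘ M
            ≡⟨ ⊘-cross M≢0 (*≢0 (*≢0 B≢0 C≢0) (*≢0 e₂≢0 e₃≢0)) N-cross ⟩
          (- (X * Y * e₁)) ⊘ (B * C * (e₂ * e₃))
            ≡⟨ cong₂ (λ g h → (- (g * e₁)) ⊘ (h * (e₂ * e₃)))
                     (sym (prodQ-* j (λ k → x k - x i) (λ k → y t l - y t k)))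
                     (sym (prodQ-* j (λ k → y t k - x i) (λ k → y t l - x k))) ⟩
          (- (prodQ j (numer i l) * e₁)) ⊘ (prodQ j (denom i l) * denom i l s)
            ≡⟨ sym (⊘-telescope-step (prodQ≢0 j (denom i l) (λ k → *≢0 (y-x≢0 k (j ℕ.+ a)) (y-x≢0 (j ℕ.+ b) k)))
                                     (*≢0 e₂≢0 e₃≢0) (Δ≢0 (j ℕ.+ a) (j ℕ.+ b)) (denom-numer i l s)) ⟩
          R i l j - R i l s
            ∎

      telescope-step : ∀ {i l j} → suc j ≤ i ⊓ l → Lm t i (suc j) * Um t (suc j) l ≡ R i l j - R i l (suc j)
      telescope-step {i} {l} s≤i⊓l = split (ℕₚ.m≤n⇒∃[o]m+o≡n (ℕₚ.≤-trans s≤i⊓l (ℕₚ.m⊓n≤m i l)))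
                                           (ℕₚ.m≤n⇒∃[o]m+o≡n (ℕₚ.≤-trans s≤i⊓l (ℕₚ.m⊓n≤n i l)))
        where
        split : ∀ {i l j} → ∃[ a ] suc j ℕ.+ a ≡ i → ∃[ b ] suc j ℕ.+ b ≡ l →
                Lm t i (suc j) * Um t (suc j) l ≡ R i l j - R i l (suc j)
        split {j = j} (a , refl) (b , refl) = Step.Lm*Um≡R-R j a b

open import Data.Nat using (ℕ; _≤_; _⊓_; _*_; _∸_)
open import Data.Rational using (ℚ; 0ℚ; _-_)

mainTheorem4 : (t : ℚ)
    → (∀ (a b : ℕ) → 1 ≤ a → 1 ≤ b
         → Data.Rational._*_ (pow (ι (2 * b ∸ 1)) 2) (pow t 2) ≢ pow (ι (2 * a)) 2)
    → ∀ (i l : ℕ) → 1 ≤ i → 1 ≤ l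
    → sumQ (i ⊓ l) (λ j → Data.Rational._*_ (Lm t i j) (Um t j l)) ≡ Nm t i l
mainTheorem4 t y≢x i l 1≤i 1≤l = begin
  sumQ (i ⊓ l) (λ j → Data.Rational._*_ (Lm t i j) (Um t j l))
    ≡⟨ sumQ-telescope (i ⊓ l) (R t i l) (telescope-step t y≢x) ⟩
  R t i l 0 - R t i l (i ⊓ l)
    ≡⟨ cong₂ _-_ (R-zero t i l) (R-vanishes t 1≤i 1≤l) ⟩
  Nm t i l - 0ℚ
    ≡⟨ ℚₚ.+-identityʳ (Nm t i l) ⟩
  Nm t i l
    ∎
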